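{- Let $\varphi$ be a red–green–blue coloring of $E(K_n)$. If $\varphi$ has no triangle whose three edges are all red and no triangle with exactly two red edges and one green edge, then $$e_r(\varphi)\le e_b(\varphi)+\Big\lfloor\frac n2\Big\rfloor.$$
   Context: $e_r(\varphi)$ and $e_b(\varphi)$ denote the numbers of red and blue edges of $\varphi$. -}

module Defs where

open import Data.Nat using (ℕ; _<?_)
open import Data.Fin using (Fin; toℕ)
open import Data.List using (List; length; filter; allFin; concatMap)
open import Data.Product using (_×_; _,_)
open import Relation.Nullary using (Dec; yes; no)
open import Relation.Nullary.Decidable using (_×-dec_)
open import Relation.Binary.PropositionalEquality using (_≡_; refl)

data Colour : Set where
  red green blue : Colour

_≟c_ : (a b : Colour) → Dec (a ≡ b)
red ≟c red = yes refl
red ≟c green = no λ ()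
red ≟c blue = no λ ()
green ≟c red = no λ ()
green ≟c green = yes refl
green ≟c blue = no λ ()
blue ≟c red = no λ ()
blue ≟c green = no λ ()
blue ≟c blue = yes refl

-- A colouring of E(K_n): a symmetric function on pairs of vertices
-- (values on the diagonal are irrelevant).
Colouring : ℕ → Set
Colouring n = Fin n → Fin n → Colour

Symmetric : ∀ {n} → Colouring n → Set
Symmetric {n} φ = (i j : Fin n) → φ i j ≡ φ j i

edges : (n : ℕ) → List (Fin n × Fin n)
edges n = filter (λ { (i , j) → toℕ i <? toℕ j })
            (concatMap (λ i → Data.List.map (λ j → (i , j)) (allFin n)) (allFin n))

edgeCount : ∀ {n} → Colouring n → Colour → ℕ
edgeCount {n} φ c = length (filter (λ { (i , j) → φ i j ≟c c }) (edges n))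

e-r : ∀ {n} → Colouring n → ℕ
e-r φ = edgeCount φ red

e-b : ∀ {n} → Colouring n → ℕ
e-b φ = edgeCount φ blue

-- Write d_c(x) for the number of c-coloured edges at x, so that Σ_x d_r(x) = 2 e_r and
-- Σ_x d_b(x) = 2 e_b; it suffices to show Σ d_r ≤ Σ d_b + n, by induction on n.  If there
-- is no red edge this is trivial.  Otherwise let uv be red.  For every other vertex y, if
-- vy is red then uy is blue (it is not red by the first hypothesis and not green by the
-- second), and symmetrically.  So the red edges from u and v to the rest of the graph are
-- outnumbered by the blue ones, and deleting u and v lowers Σ d_r by at most
-- 2 = |{u, v}| more than it lowers Σ d_b.
module Submission where

open import Defs
open import Data.Nat using (ℕ; zero; suc; _≤_; _+_; _*_; _/_; z≤n; s≤s; _<?_)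
open import Data.Nat.Properties
  using (+-0-commutativeMonoid; ≤-refl; ≤-reflexive; ≤-trans; ≤-antisym; +-mono-≤;
         +-monoˡ-≤; *-monoʳ-≤; m≤n+m; *-comm; *-distribʳ-+; +-identityʳ; +-assoc; module ≤-Reasoning)
open import Data.Nat.DivMod using (/-monoˡ-≤; m*n/n≡m; +-distrib-/-∣ˡ)
open import Data.Nat.Divisibility using (m∣m*n)
open import Data.Nat.ListAction using () renaming (sum to listSum)
open import Data.Nat.ListAction.Properties using () renaming (sum-++ to listSum-++)
open import Data.Nat.Solver using (module +-*-Solver)
open import Algebra.Properties.CommutativeMonoid.Sum +-0-commutativeMonoid
  using (sum-syntax; sum-remove; ∑-distrib-+; ∑-comm; sum-cong-≗; sum-replicate-zero)
open import Data.Fin using (Fin; zero; suc; toℕ; punchIn)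
open import Data.Fin.Properties
  using (_≟_; <-cmp; any?; punchIn-injective; punchInᵢ≢i)
open import Data.List using (List; []; _∷_; _++_; length; map; filter; concatMap; tabulate; allFin)
open import Data.List.Properties using (map-++; map-tabulate)
open import Data.Empty using (⊥-elim)
open import Data.Product using (_×_; _,_; ∃₂)
open import Function using (_∘_)
open import Relation.Binary.Definitions using (tri<; tri≈; tri>)
open import Relation.Binary.PropositionalEquality
  using (_≡_; _≢_; refl; sym; trans; cong; cong₂; subst₂; module ≡-Reasoning)
open import Relation.Nullary using (¬_; Dec; yes; no)
open import Relation.Nullary.Decidable using (¬?)
open import Relation.Unary using (Decidable)

χ : ∀ {p} {P : Set p} → Dec P → ℕ
χ (yes _) = 1
χ (no _) = 0

χ-yes : ∀ {p} {P : Set p} (P? : Dec P) → P → χ P? ≡ 1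
χ-yes (yes _) _ = refl
χ-yes (no ¬p) p = ⊥-elim (¬p p)

χ-no : ∀ {p} {P : Set p} (P? : Dec P) → ¬ P → χ P? ≡ 0
χ-no (yes p) ¬p = ⊥-elim (¬p p)
χ-no (no _) _ = refl

χ-mono : ∀ {p q} {P : Set p} {Q : Set q} (P? : Dec P) (Q? : Dec Q) → (P → Q) → χ P? ≤ χ Q?
χ-mono (yes _) (yes _) _ = ≤-refl
χ-mono (yes p) (no ¬q) P⇒Q = ⊥-elim (¬q (P⇒Q p))
χ-mono (no _) Q? _ = z≤n

χ-cong : ∀ {p q} {P : Set p} {Q : Set q} (P? : Dec P) (Q? : Dec Q) →
         (P → Q) → (Q → P) → χ P? ≡ χ Q?
χ-cong P? Q? P⇒Q Q⇒P = ≤-antisym (χ-mono P? Q? P⇒Q) (χ-mono Q? P? Q⇒P)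

sum-mono-≤ : ∀ {n} {f g : Fin n → ℕ} → (∀ i → f i ≤ g i) → ∑[ i < n ] f i ≤ ∑[ i < n ] g i
sum-mono-≤ {zero} f≤g = z≤n
sum-mono-≤ {suc n} f≤g = +-mono-≤ (f≤g zero) (sum-mono-≤ (f≤g ∘ suc))

sum-zero : ∀ {n} {f : Fin n → ℕ} → (∀ i → f i ≡ 0) → ∑[ i < n ] f i ≡ 0
sum-zero {n} f≡0 = trans (sum-cong-≗ f≡0) (sum-replicate-zero n)

length-filter-filter : ∀ {a p q} {A : Set a} {P : A → Set p} {Q : A → Set q}
  (P? : Decidable P) (Q? : Decidable Q) (xs : List A) →
  length (filter Q? (filter P? xs)) ≡ listSum (map (λ x → χ (P? x) * χ (Q? x)) xs)
length-filter-filter P? Q? [] = refl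
length-filter-filter P? Q? (x ∷ xs) with P? x
... | no _ = length-filter-filter P? Q? xs
... | yes _ with Q? x
...   | no _ = length-filter-filter P? Q? xs
...   | yes _ = cong suc (length-filter-filter P? Q? xs)

listSum-map-tabulate : ∀ {a} {A : Set a} {n} (h : A → ℕ) (g : Fin n → A) →
  listSum (map h (tabulate g)) ≡ ∑[ i < n ] h (g i)
listSum-map-tabulate {n = zero} h g = refl
listSum-map-tabulate {n = suc n} h g = cong (h (g zero) +_) (listSum-map-tabulate h (g ∘ suc))

listSum-map-concatMap-tabulate : ∀ {a b} {A : Set a} {B : Set b} {n}
  (h : B → ℕ) (f : A → List B) (g : Fin n → A) →
  listSum (map h (concatMap f (tabulate g))) ≡ ∑[ i < n ] listSum (map h (f (g i)))
listSum-map-concatMap-tabulate {n = zero} h f g = refl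
listSum-map-concatMap-tabulate {n = suc n} h f g = begin
  listSum (map h (f (g zero) ++ concatMap f (tabulate (g ∘ suc))))
    ≡⟨ cong listSum (map-++ h (f (g zero)) _) ⟩
  listSum (map h (f (g zero)) ++ map h (concatMap f (tabulate (g ∘ suc))))
    ≡⟨ listSum-++ (map h (f (g zero))) _ ⟩
  listSum (map h (f (g zero))) + listSum (map h (concatMap f (tabulate (g ∘ suc))))
    ≡⟨ cong (listSum (map h (f (g zero))) +_) (listSum-map-concatMap-tabulate h f (g ∘ suc)) ⟩
  listSum (map h (f (g zero))) + ∑[ i < n ] listSum (map h (f (g (suc i)))) ∎
  where open ≡-Reasoning

offDiagonal : ∀ {n} → Fin n → Fin n → ℕ
offDiagonal x y = χ (¬? (x ≟ y))

offDiagonal≡χ<+χ> : ∀ {n} (i j : Fin n) →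
  offDiagonal i j ≡ χ (toℕ i <? toℕ j) + χ (toℕ j <? toℕ i)
offDiagonal≡χ<+χ> i j with <-cmp i j
... | tri< i<j i≢j j≮i = trans (χ-yes (¬? (i ≟ j)) i≢j)
                          (sym (cong₂ _+_ (χ-yes (toℕ i <? toℕ j) i<j) (χ-no (toℕ j <? toℕ i) j≮i)))
... | tri≈ i≮j i≡j j≮i = trans (χ-no (¬? (i ≟ j)) (λ i≢j → i≢j i≡j))
                          (sym (cong₂ _+_ (χ-no (toℕ i <? toℕ j) i≮j) (χ-no (toℕ j <? toℕ i) j≮i)))
... | tri> i≮j i≢j j<i = trans (χ-yes (¬? (i ≟ j)) i≢j)
                          (sym (cong₂ _+_ (χ-no (toℕ i <? toℕ j) i≮j) (χ-yes (toℕ j <? toℕ i) j<i)))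

module _ {n : ℕ} (φ : Colouring n) where

  isColour : Colour → Fin n → Fin n → ℕ
  isColour c x y = χ (φ x y ≟c c)

  degree : Colour → Fin n → ℕ
  degree c x = ∑[ y < n ] (offDiagonal x y * isColour c x y)

  degreeSum : Colour → ℕ
  degreeSum c = ∑[ x < n ] degree c x

  edgeCount≡∑ : ∀ c → edgeCount φ c ≡ ∑[ i < n ] ∑[ j < n ] (χ (toℕ i <? toℕ j) * isColour c i j)
  edgeCount≡∑ c = begin
    edgeCount φ c
      ≡⟨ length-filter-filter _ _ (concatMap row (allFin n)) ⟩
    listSum (map h (concatMap row (allFin n)))
      ≡⟨ listSum-map-concatMap-tabulate h row (λ i → i) ⟩
    ∑[ i < n ] listSum (map h (row i))
      ≡⟨ sum-cong-≗ (λ i → trans (cong (listSum ∘ map h) (map-tabulate (λ j → j) (i ,_)))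
                                 (listSum-map-tabulate h (i ,_))) ⟩
    ∑[ i < n ] ∑[ j < n ] (χ (toℕ i <? toℕ j) * isColour c i j) ∎
    where
    open ≡-Reasoning
    row : Fin n → List (Fin n × Fin n)
    row i = map (i ,_) (allFin n)
    h : Fin n × Fin n → ℕ
    h (i , j) = χ (toℕ i <? toℕ j) * isColour c i j

degreeSum≡2*edgeCount : ∀ {n} (φ : Colouring n) → Symmetric φ → ∀ c →
                        degreeSum φ c ≡ 2 * edgeCount φ c
degreeSum≡2*edgeCount {n} φ φ-sym c = begin
  degreeSum φ c
    ≡⟨ sum-cong-≗ (λ i → sum-cong-≗ (λ j → cong (_* isColour φ c i j) (offDiagonal≡χ<+χ> i j))) ⟩
  ∑[ i < n ] ∑[ j < n ] ((lt i j + lt j i) * isColour φ c i j)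
    ≡⟨ sum-cong-≗ (λ i → sum-cong-≗ (λ j → *-distribʳ-+ (isColour φ c i j) (lt i j) (lt j i))) ⟩
  ∑[ i < n ] ∑[ j < n ] (lt i j * isColour φ c i j + lt j i * isColour φ c i j)
    ≡⟨ sum-cong-≗ (λ i → ∑-distrib-+ (λ j → lt i j * isColour φ c i j) _) ⟩
  ∑[ i < n ] (∑[ j < n ] (lt i j * isColour φ c i j) + ∑[ j < n ] (lt j i * isColour φ c i j))
    ≡⟨ ∑-distrib-+ (λ i → ∑[ j < n ] (lt i j * isColour φ c i j)) _ ⟩
  e + ∑[ i < n ] ∑[ j < n ] (lt j i * isColour φ c i j)
    ≡⟨ cong (e +_) (∑-comm (λ i j → lt j i * isColour φ c i j)) ⟩
  e + ∑[ j < n ] ∑[ i < n ] (lt j i * isColour φ c i j)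
    ≡⟨ cong (e +_) (sum-cong-≗ (λ j → sum-cong-≗ (λ i →
         cong (λ d → lt j i * χ (d ≟c c)) (φ-sym i j)))) ⟩
  e + e
    ≡⟨ cong (e +_) (sym (+-identityʳ e)) ⟩
  2 * e
    ≡⟨ cong (2 *_) (sym (edgeCount≡∑ φ c)) ⟩
  2 * edgeCount φ c ∎
  where
  open ≡-Reasoning
  lt : Fin n → Fin n → ℕ
  lt i j = χ (toℕ i <? toℕ j)
  e : ℕ
  e = ∑[ i < n ] ∑[ j < n ] (lt i j * isColour φ c i j)

removeVertex : ∀ {n} → Colouring (suc n) → Fin (suc n) → Colouring n
removeVertex φ u x y = φ (punchIn u x) (punchIn u y)

offDiagonal-refl : ∀ {n} (x : Fin n) → offDiagonal x x ≡ 0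
offDiagonal-refl x = χ-no (¬? (x ≟ x)) (λ x≢x → x≢x refl)

offDiagonal-punchInᵢ : ∀ {n} (u : Fin (suc n)) (y : Fin n) → offDiagonal u (punchIn u y) ≡ 1
offDiagonal-punchInᵢ u y = χ-yes (¬? (u ≟ punchIn u y)) (punchInᵢ≢i u y ∘ sym)

offDiagonal-punchIn : ∀ {n} (u : Fin (suc n)) (x y : Fin n) →
                      offDiagonal (punchIn u x) (punchIn u y) ≡ offDiagonal x y
offDiagonal-punchIn u x y = χ-cong (¬? (punchIn u x ≟ punchIn u y)) (¬? (x ≟ y))
  (λ ux≢uy x≡y → ux≢uy (cong (punchIn u) x≡y))
  (λ x≢y ux≡uy → x≢y (punchIn-injective u x y ux≡uy))

module _ {n : ℕ} (φ : Colouring (suc n)) (u : Fin (suc n)) where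

  degree-punchIn : ∀ c → degree φ c u ≡ ∑[ y < n ] isColour φ c u (punchIn u y)
  degree-punchIn c = begin
    degree φ c u
      ≡⟨ sum-remove {i = u} (λ y → offDiagonal u y * isColour φ c u y) ⟩
    offDiagonal u u * isColour φ c u u
      + ∑[ y < n ] (offDiagonal u (punchIn u y) * isColour φ c u (punchIn u y))
      ≡⟨ cong₂ _+_ (cong (_* isColour φ c u u) (offDiagonal-refl u)) (sum-cong-≗ λ y →
           trans (cong (_* isColour φ c u (punchIn u y)) (offDiagonal-punchInᵢ u y)) (+-identityʳ _)) ⟩
    ∑[ y < n ] isColour φ c u (punchIn u y) ∎
    where open ≡-Reasoning

  degreeSum-removeVertex : Symmetric φ → ∀ c →
                           degreeSum φ c ≡ 2 * degree φ c u + degreeSum (removeVertex φ u) c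
  degreeSum-removeVertex φ-sym c = begin
    degreeSum φ c
      ≡⟨ sum-remove {i = u} (degree φ c) ⟩
    d + ∑[ x < n ] degree φ c (punchIn u x)
      ≡⟨ cong (d +_) (sum-cong-≗ degree-punchIn-other) ⟩
    d + ∑[ x < n ] (isColour φ c u (punchIn u x) + degree (removeVertex φ u) c x)
      ≡⟨ cong (d +_) (∑-distrib-+ (isColour φ c u ∘ punchIn u) _) ⟩
    d + (∑[ x < n ] isColour φ c u (punchIn u x) + degreeSum (removeVertex φ u) c)
      ≡⟨ cong (λ d′ → d + (d′ + degreeSum (removeVertex φ u) c)) (sym (degree-punchIn c)) ⟩
    d + (d + degreeSum (removeVertex φ u) c)
      ≡⟨ sym (+-assoc d d _) ⟩
    d + d + degreeSum (removeVertex φ u) c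
      ≡⟨ cong (λ d′ → d + d′ + degreeSum (removeVertex φ u) c) (sym (+-identityʳ d)) ⟩
    2 * d + degreeSum (removeVertex φ u) c ∎
    where
    open ≡-Reasoning
    d : ℕ
    d = degree φ c u
    degree-punchIn-other : ∀ x →
      degree φ c (punchIn u x) ≡ isColour φ c u (punchIn u x) + degree (removeVertex φ u) c x
    degree-punchIn-other x = begin
      degree φ c x′
        ≡⟨ sum-remove {i = u} (λ y → offDiagonal x′ y * isColour φ c x′ y) ⟩
      offDiagonal x′ u * isColour φ c x′ u
        + ∑[ y < n ] (offDiagonal x′ (punchIn u y) * isColour φ c x′ (punchIn u y))
        ≡⟨ cong₂ _+_ edge-to-u (sum-cong-≗ λ y →
             cong (_* isColour φ c x′ (punchIn u y)) (offDiagonal-punchIn u x y)) ⟩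
      isColour φ c u x′ + degree (removeVertex φ u) c x ∎
      where
      x′ : Fin (suc n)
      x′ = punchIn u x
      edge-to-u : offDiagonal x′ u * isColour φ c x′ u ≡ isColour φ c u x′
      edge-to-u = begin
        offDiagonal x′ u * isColour φ c x′ u
          ≡⟨ cong (_* isColour φ c x′ u) (χ-yes (¬? (x′ ≟ u)) (punchInᵢ≢i u x)) ⟩
        isColour φ c x′ u + 0
          ≡⟨ +-identityʳ _ ⟩
        isColour φ c x′ u
          ≡⟨ cong (λ d′ → χ (d′ ≟c c)) (φ-sym x′ u) ⟩
        isColour φ c u x′ ∎

NoRedTriangle : ∀ {n} → Colouring n → Set
NoRedTriangle {n} φ = (i j k : Fin n) → i ≢ j → j ≢ k → i ≢ k
  → ¬ (φ i j ≡ red × φ j k ≡ red × φ i k ≡ red)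

NoRedRedGreenTriangle : ∀ {n} → Colouring n → Set
NoRedRedGreenTriangle {n} φ = (i j k : Fin n) → i ≢ j → j ≢ k → i ≢ k
  → ¬ (φ i j ≡ red × φ j k ≡ red × φ i k ≡ green)

RedPathsCloseBlue : ∀ {n} → Colouring n → Set
RedPathsCloseBlue {n} φ = (i j k : Fin n) → i ≢ j → j ≢ k → i ≢ k
  → φ i j ≡ red → φ j k ≡ red → φ i k ≡ blue

redPathsCloseBlue : ∀ {n} {φ : Colouring n} →
  NoRedTriangle φ → NoRedRedGreenTriangle φ → RedPathsCloseBlue φ
redPathsCloseBlue {φ = φ} noRRR noRRG i j k i≢j j≢k i≢k ij-red jk-red with φ i k in ik
... | red = ⊥-elim (noRRR i j k i≢j j≢k i≢k (ij-red , jk-red , ik))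
... | green = ⊥-elim (noRRG i j k i≢j j≢k i≢k (ij-red , jk-red , ik))
... | blue = refl

Symmetric-removeVertex : ∀ {n} {φ : Colouring (suc n)} u → Symmetric φ → Symmetric (removeVertex φ u)
Symmetric-removeVertex u φ-sym x y = φ-sym (punchIn u x) (punchIn u y)

RedPathsCloseBlue-removeVertex : ∀ {n} {φ : Colouring (suc n)} u →
  RedPathsCloseBlue φ → RedPathsCloseBlue (removeVertex φ u)
RedPathsCloseBlue-removeVertex u rpcb i j k i≢j j≢k i≢k =
  rpcb (punchIn u i) (punchIn u j) (punchIn u k)
    (i≢j ∘ punchIn-injective u i j) (j≢k ∘ punchIn-injective u j k) (i≢k ∘ punchIn-injective u i k)

redNeighbours≤blueNeighbours : ∀ {n k} {φ : Colouring n} → RedPathsCloseBlue φ →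
  ∀ {x y} → x ≢ y → φ x y ≡ red → (ρ : Fin k → Fin n) → (∀ z → ρ z ≢ x) → (∀ z → ρ z ≢ y) →
  ∑[ z < k ] isColour φ red y (ρ z) ≤ ∑[ z < k ] isColour φ blue x (ρ z)
redNeighbours≤blueNeighbours {φ = φ} rpcb {x} {y} x≢y xy-red ρ ρ≢x ρ≢y = sum-mono-≤ λ z →
  χ-mono (φ y (ρ z) ≟c red) (φ x (ρ z) ≟c blue)
    (rpcb x y (ρ z) x≢y (ρ≢y z ∘ sym) (ρ≢x z ∘ sym) xy-red)

module _ {m : ℕ} (φ : Colouring (suc (suc m))) (φ-sym : Symmetric φ)
         (u : Fin (suc (suc m))) (v₁ : Fin (suc m)) where

  private
    v : Fin (suc (suc m))
    v = punchIn u v₁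

    ρ : Fin m → Fin (suc (suc m))
    ρ z = punchIn u (punchIn v₁ z)

    ρ≢u : ∀ z → ρ z ≢ u
    ρ≢u z = punchInᵢ≢i u (punchIn v₁ z)

    ρ≢v : ∀ z → ρ z ≢ v
    ρ≢v z = punchInᵢ≢i v₁ z ∘ punchIn-injective u (punchIn v₁ z) v₁

  restDegree : Colour → Fin (suc (suc m)) → ℕ
  restDegree c x = ∑[ z < m ] isColour φ c x (ρ z)

  degreeSum-removeEdge : ∀ c → degreeSum φ c ≡
    2 * (isColour φ c u v + (restDegree c u + restDegree c v))
      + degreeSum (removeVertex (removeVertex φ u) v₁) c
  degreeSum-removeEdge c = begin
    degreeSum φ c
      ≡⟨ degreeSum-removeVertex φ u φ-sym c ⟩
    2 * degree φ c u + degreeSum φ₁ c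
      ≡⟨ cong (2 * degree φ c u +_) (degreeSum-removeVertex φ₁ v₁ (Symmetric-removeVertex u φ-sym) c) ⟩
    2 * degree φ c u + (2 * degree φ₁ c v₁ + D)
      ≡⟨ cong₂ (λ a b → 2 * a + (2 * b + D))
           (trans (degree-punchIn φ u c) (sum-remove {i = v₁} (isColour φ c u ∘ punchIn u)))
           (degree-punchIn φ₁ v₁ c) ⟩
    2 * (isColour φ c u v + restDegree c u) + (2 * restDegree c v + D)
      ≡⟨ solve 4 (λ a r s d → con 2 :* (a :+ r) :+ (con 2 :* s :+ d) := con 2 :* (a :+ (r :+ s)) :+ d)
           refl (isColour φ c u v) (restDegree c u) (restDegree c v) D ⟩
    2 * (isColour φ c u v + (restDegree c u + restDegree c v)) + D ∎
    where
    open ≡-Reasoning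
    open +-*-Solver
    φ₁ : Colouring (suc m)
    φ₁ = removeVertex φ u
    D : ℕ
    D = degreeSum (removeVertex φ₁ v₁) c

  degreeSum-red≤blue-removeRedEdge : RedPathsCloseBlue φ → φ u v ≡ red →
    let φ₂ = removeVertex (removeVertex φ u) v₁ in
    degreeSum φ₂ red ≤ degreeSum φ₂ blue + m →
    degreeSum φ red ≤ degreeSum φ blue + suc (suc m)
  degreeSum-red≤blue-removeRedEdge rpcb uv-red IH = begin
    degreeSum φ red
      ≡⟨ degreeSum-removeEdge red ⟩
    2 * (isColour φ red u v + (Ru + Rv)) + Dr
      ≡⟨ cong (λ a → 2 * (a + (Ru + Rv)) + Dr) (χ-yes (φ u v ≟c red) uv-red) ⟩
    2 * (1 + (Ru + Rv)) + Dr
      ≤⟨ +-mono-≤ (*-monoʳ-≤ 2 (s≤s (+-mono-≤ Ru≤Bv Rv≤Bu))) IH ⟩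
    2 * (1 + (Bv + Bu)) + (Db + m)
      ≡⟨ solve 4 (λ bu bv d k → con 2 :* (con 1 :+ (bv :+ bu)) :+ (d :+ k)
                                := con 2 :* (bu :+ bv) :+ d :+ (con 2 :+ k)) refl Bu Bv Db m ⟩
    2 * (Bu + Bv) + Db + suc (suc m)
      ≤⟨ +-monoˡ-≤ (suc (suc m)) (+-monoˡ-≤ Db (*-monoʳ-≤ 2 (m≤n+m (Bu + Bv) (isColour φ blue u v)))) ⟩
    2 * (isColour φ blue u v + (Bu + Bv)) + Db + suc (suc m)
      ≡⟨ cong (_+ suc (suc m)) (degreeSum-removeEdge blue) ⟨
    degreeSum φ blue + suc (suc m) ∎
    where
    open ≤-Reasoning
    open +-*-Solver
    Ru = restDegree red u
    Rv = restDegree red v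
    Bu = restDegree blue u
    Bv = restDegree blue v
    Dr = degreeSum (removeVertex (removeVertex φ u) v₁) red
    Db = degreeSum (removeVertex (removeVertex φ u) v₁) blue
    u≢v : u ≢ v
    u≢v = punchInᵢ≢i u v₁ ∘ sym
    Ru≤Bv : Ru ≤ Bv
    Ru≤Bv = redNeighbours≤blueNeighbours rpcb (u≢v ∘ sym) (trans (φ-sym v u) uv-red) ρ ρ≢v ρ≢u
    Rv≤Bu : Rv ≤ Bu
    Rv≤Bu = redNeighbours≤blueNeighbours rpcb u≢v uv-red ρ ρ≢u ρ≢v

degreeSum-red≡0 : ∀ {n} (φ : Colouring (suc n)) →
  ¬ (∃₂ λ u v → φ u (punchIn u v) ≡ red) → degreeSum φ red ≡ 0
degreeSum-red≡0 φ noRedEdge = sum-zero λ u → trans (degree-punchIn φ u red)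
  (sum-zero λ v → χ-no (φ u (punchIn u v) ≟c red) (λ uv-red → noRedEdge (u , v , uv-red)))

-- Red edges are searched for as {u, punchIn u v}, which ranges over all pairs of distinct
-- vertices and, once one is found, exposes n = suc (suc m) for the recursive call.
degreeSum-red≤blue+n : ∀ n (φ : Colouring n) → Symmetric φ → RedPathsCloseBlue φ →
                       degreeSum φ red ≤ degreeSum φ blue + n
degreeSum-red≤blue+n zero φ φ-sym rpcb = z≤n
degreeSum-red≤blue+n (suc n) φ φ-sym rpcb with any? (λ u → any? (λ v → φ u (punchIn u v) ≟c red))
... | no noRedEdge = ≤-trans (≤-reflexive (degreeSum-red≡0 φ noRedEdge)) z≤n
degreeSum-red≤blue+n (suc zero) φ φ-sym rpcb | yes (u , () , _)
degreeSum-red≤blue+n (suc (suc m)) φ φ-sym rpcb | yes (u , v₁ , uv-red) =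
  degreeSum-red≤blue-removeRedEdge φ φ-sym u v₁ rpcb uv-red
    (degreeSum-red≤blue+n m (removeVertex (removeVertex φ u) v₁)
      (Symmetric-removeVertex v₁ (Symmetric-removeVertex u φ-sym))
      (RedPathsCloseBlue-removeVertex v₁ (RedPathsCloseBlue-removeVertex u rpcb)))

halve-≤ : ∀ a b n → 2 * a ≤ 2 * b + n → a ≤ b + n / 2
halve-≤ a b n 2a≤2b+n = begin
  a               ≡⟨ halve-double a ⟨
  2 * a / 2       ≤⟨ /-monoˡ-≤ 2 2a≤2b+n ⟩
  (2 * b + n) / 2 ≡⟨ +-distrib-/-∣ˡ n (m∣m*n b) ⟩
  2 * b / 2 + n / 2 ≡⟨ cong (_+ n / 2) (halve-double b) ⟩
  b + n / 2       ∎
  where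
  open ≤-Reasoning
  halve-double : ∀ x → 2 * x / 2 ≡ x
  halve-double x = trans (cong (_/ 2) (*-comm 2 x)) (m*n/n≡m x 2)

lemma3p2 : (n : ℕ) (φ : Colouring n) → Symmetric φ
    → ((i j k : Fin n) → i ≢ j → j ≢ k → i ≢ k
         → ¬ (φ i j ≡ red × φ j k ≡ red × φ i k ≡ red))
    → ((i j k : Fin n) → i ≢ j → j ≢ k → i ≢ k
         → ¬ (φ i j ≡ red × φ j k ≡ red × φ i k ≡ green))
    → e-r φ ≤ e-b φ + n / 2
lemma3p2 n φ φ-sym noRRR noRRG = halve-≤ (e-r φ) (e-b φ) n
  (subst₂ _≤_ (degreeSum≡2*edgeCount φ φ-sym red)
              (cong (_+ n) (degreeSum≡2*edgeCount φ φ-sym blue))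
              (degreeSum-red≤blue+n n φ φ-sym (redPathsCloseBlue noRRR noRRG)))
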